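{- $R(\sqsubseteq,*)$ is exactly the class of ordered semigroups: a structure $(A,\leq,\cdot)$ is isomorphic to a set of binary relations on some non-empty set closed under demonic composition and ordered by demonic refinement if and only if it is an ordered semigroup.
   Context: For a non-empty set $X$, $\mathrm{Rel}(X)$ is the set of binary relations on $X$. Demonic composition: $s*t=\{(x,y):\exists z((x,z)\in s\wedge(z,y)\in t)\wedge\forall w((x,w)\in s\to\exists v\,(w,v)\in t)\}$. Demonic refinement: $s\sqsubseteq t$ iff $\mathrm{dom}(t)\subseteq\mathrm{dom}(s)$ and $s|_{\mathrm{dom}(t)}\subseteq t$ (restriction in domain). $R(\sqsubseteq,*)$ is the closure under isomorphism of the class of structures $(B,\sqsubseteq,*)$ with $B\subseteq\mathrm{Rel}(X)$ closed under $*$. An ordered semigroup is $(A,\leq,\cdot)$ with $\cdot$ associative, $\leq$ a partial order, and $\cdot$ monotone in both arguments ($a\leq b$ implies $ca\leq cb$ and $ac\leq bc$). -}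

module Defs where

open import Data.Product using (Σ; ∃; ∃-syntax; _×_; _,_)
open import Relation.Binary.PropositionalEquality using (_≡_)
open import Relation.Binary.Structures using (IsPartialOrder)
open import Algebra.Definitions using (Associative)
open import Function.Bundles using (_⇔_)

BinRel : Set → Set₁
BinRel X = X → X → Set

module _ {X : Set} where

  _⊆ʳ_ : BinRel X → BinRel X → Set
  s ⊆ʳ t = ∀ x y → s x y → t x y

  _≈ʳ_ : BinRel X → BinRel X → Set
  s ≈ʳ t = (s ⊆ʳ t) × (t ⊆ʳ s)

  dom : BinRel X → X → Set
  dom s x = ∃[ y ] s x y

  _*_ : BinRel X → BinRel X → BinRel X
  (s * t) x y = (∃[ z ] (s x z × t z y)) × (∀ w → s x w → ∃[ v ] t w v)

  _⊑_ : BinRel X → BinRel X → Set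
  s ⊑ t = (∀ x → dom t x → dom s x) × (∀ x y → dom t x → s x y → t x y)

record IsOrderedSemigroup (A : Set) (_≤_ : A → A → Set) (_·_ : A → A → A) : Set where
  field
    isPartialOrder : IsPartialOrder _≡_ _≤_
    assoc          : Associative _≡_ _·_
    monoˡ          : ∀ {a b} c → a ≤ b → (c · a) ≤ (c · b)
    monoʳ          : ∀ {a b} c → a ≤ b → (a · c) ≤ (b · c)

-- B is a predicate on relations; relations are identified up to
-- extensional equality ≈ʳ.
record Representation (A : Set) (_≤_ : A → A → Set) (_·_ : A → A → A) : Set₁ where
  field
    X         : Set
    x₀        : X                                  -- X non-empty
    B         : BinRel X → Set
    B-resp    : ∀ {s t} → s ≈ʳ t → B s → B t
    B-closed  : ∀ {s t} → B s → B t → B (s * t)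
    f         : A → BinRel X
    f-into    : ∀ a → B (f a)
    f-inj     : ∀ a b → f a ≈ʳ f b → a ≡ b
    f-surj    : ∀ s → B s → ∃[ a ] (f a ≈ʳ s)
    f-hom     : ∀ a b → f (a · b) ≈ʳ (f a * f b)
    f-order   : ∀ a b → (a ≤ b) ⇔ (f a ⊑ f b)

InRDemonic : (A : Set) (_≤_ : A → A → Set) (_·_ : A → A → A) → Set₁
InRDemonic A _≤_ _·_ = Representation A _≤_ _·_

-- Soundness: the laws of an ordered semigroup hold for demonic composition and
-- refinement of arbitrary relations (associativity only up to extensional
-- equality), and transfer along the isomorphism.
--
-- Completeness: adjoin an identity to A and represent a by the relation
-- x ρ(a) y  ⇔  y ≤ x · a.  These relations are total, and for total relations
-- demonic composition is ordinary composition and refinement is inclusion, so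
-- ρ(a · b) = ρ(a) ; ρ(b) amounts to "y ≤ x·a·b iff y ≤ z·b for some z ≤ x·a",
-- and ρ(a) ⊆ ρ(b) iff a ≤ b (evaluate at the adjoined identity).
module Submission where

open import Defs
open import Data.Product using (_×_; _,_; proj₁; proj₂; ∃-syntax)
open import Data.Maybe using (Maybe; just; nothing)
open import Data.Empty using (⊥)
open import Level using (0ℓ) renaming (suc to lsuc)
open import Relation.Binary.PropositionalEquality using (_≡_; refl; sym; isEquivalence)
open import Relation.Binary.Bundles using (Setoid)
open import Relation.Binary.Structures using (IsPartialOrder)
open import Function.Bundles using (_⇔_; mk⇔; Equivalence)
import Relation.Binary.Reasoning.Setoid as SetoidReasoning

module Relations {X : Set} where

  ≈ʳ-refl : ∀ {s : BinRel X} → s ≈ʳ s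
  ≈ʳ-refl = (λ _ _ p → p) , (λ _ _ p → p)

  ≈ʳ-sym : ∀ {s t : BinRel X} → s ≈ʳ t → t ≈ʳ s
  ≈ʳ-sym (s⊆t , t⊆s) = t⊆s , s⊆t

  ≈ʳ-trans : ∀ {s t u : BinRel X} → s ≈ʳ t → t ≈ʳ u → s ≈ʳ u
  ≈ʳ-trans (s⊆t , t⊆s) (t⊆u , u⊆t) =
    (λ x y p → t⊆u x y (s⊆t x y p)) , (λ x y p → t⊆s x y (u⊆t x y p))

  ≈ʳ-setoid : Setoid (lsuc 0ℓ) 0ℓ
  ≈ʳ-setoid = record
    { Carrier       = BinRel X
    ; _≈_           = _≈ʳ_
    ; isEquivalence = record { refl = ≈ʳ-refl ; sym = ≈ʳ-sym ; trans = ≈ʳ-trans }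
    }

  ⊑-refl : ∀ {s : BinRel X} → s ⊑ s
  ⊑-refl = (λ _ d → d) , (λ _ _ _ p → p)

  ⊑-trans : ∀ {s t u : BinRel X} → s ⊑ t → t ⊑ u → s ⊑ u
  ⊑-trans (dom-t⊆dom-s , s⊆t) (dom-u⊆dom-t , t⊆u) =
    (λ x d → dom-t⊆dom-s x (dom-u⊆dom-t x d)) ,
    (λ x y d p → t⊆u x y d (s⊆t x y (dom-u⊆dom-t x d) p))

  ⊑-antisym : ∀ {s t : BinRel X} → s ⊑ t → t ⊑ s → s ≈ʳ t
  ⊑-antisym (dom-t⊆dom-s , s⊆t) (dom-s⊆dom-t , t⊆s) =
    (λ x y p → s⊆t x y (dom-s⊆dom-t x (y , p)) p) ,
    (λ x y p → t⊆s x y (dom-t⊆dom-s x (y , p)) p)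

  ⊑-resp-≈ʳ : ∀ {s s′ t t′ : BinRel X} → s ≈ʳ s′ → t ≈ʳ t′ → s ⊑ t → s′ ⊑ t′
  ⊑-resp-≈ʳ (s⊆s′ , s′⊆s) (t⊆t′ , t′⊆t) (dom-t⊆dom-s , s⊆t) =
    (λ x (y , t′xy) → let (z , sxz) = dom-t⊆dom-s x (y , t′⊆t x y t′xy) in z , s⊆s′ x z sxz) ,
    (λ x y (z , t′xz) s′xy → t⊆t′ x y (s⊆t x y (z , t′⊆t x z t′xz) (s′⊆s x y s′xy)))

  *-mono-⊆ʳ : ∀ {s s′ t t′ : BinRel X} → s ⊆ʳ s′ → s′ ⊆ʳ s → t ⊆ʳ t′ → (s * t) ⊆ʳ (s′ * t′)
  *-mono-⊆ʳ s⊆s′ s′⊆s t⊆t′ x y ((z , sxz , tzy) , total) =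
    (z , s⊆s′ x z sxz , t⊆t′ z y tzy) ,
    (λ w s′xw → let (v , twv) = total w (s′⊆s x w s′xw) in v , t⊆t′ w v twv)

  *-cong : ∀ {s s′ t t′ : BinRel X} → s ≈ʳ s′ → t ≈ʳ t′ → (s * t) ≈ʳ (s′ * t′)
  *-cong (s⊆s′ , s′⊆s) (t⊆t′ , t′⊆t) = *-mono-⊆ʳ s⊆s′ s′⊆s t⊆t′ , *-mono-⊆ʳ s′⊆s s⊆s′ t′⊆t

  -- Both inclusions rest on one observation: once x ∈ dom (s * t), every
  -- t-successor of an s-successor of x is an (s * t)-successor of x.
  *-assoc : ∀ (s t u : BinRel X) → ((s * t) * u) ≈ʳ (s * (t * u))
  *-assoc s t u = assocʳ , assocˡ
    where
    assocʳ : ((s * t) * u) ⊆ʳ (s * (t * u))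
    assocʳ x y ((z , ((z′ , sxz′ , tz′z) , t-total) , uzy) , u-total) =
      (z′ , sxz′ , ((z , tz′z , uzy) , λ w tz′w → u-total w (step sxz′ tz′w))) ,
      λ w sxw → let (v , twv) = t-total w sxw ; (v′ , uvv′) = u-total v (step sxw twv) in
        v′ , ((v , twv , uvv′) , λ w′ tww′ → u-total w′ (step sxw tww′))
      where
      step : ∀ {w w′} → s x w → t w w′ → (s * t) x w′
      step sxw tww′ = (_ , sxw , tww′) , t-total

    assocˡ : (s * (t * u)) ⊆ʳ ((s * t) * u)
    assocˡ x y ((z , sxz , ((m , tzm , umy) , _)) , tu-total) =
      (m , ((z , sxz , tzm) , t-total) , umy) ,
      λ { w ((z′ , sxz′ , tz′w) , _) → proj₂ (proj₂ (tu-total z′ sxz′)) w tz′w }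
      where
      t-total : ∀ w → s x w → ∃[ v ] t w v
      t-total w sxw = let (_ , ((v , twv , _) , _)) = tu-total w sxw in v , twv

  *-monoʳ-⊑ : ∀ (r : BinRel X) {s t : BinRel X} → s ⊑ t → (r * s) ⊑ (r * t)
  *-monoʳ-⊑ r (dom-t⊆dom-s , s⊆t) =
    (λ x (y , ((z , rxz , tzy) , t-total)) →
      let (y′ , szy′) = dom-t⊆dom-s z (y , tzy) in
      y′ , ((z , rxz , szy′) , λ w rxw → dom-t⊆dom-s w (t-total w rxw))) ,
    (λ x y (_ , (_ , t-total)) ((z , rxz , szy) , _) →
      (z , rxz , s⊆t z y (t-total z rxz) szy) , t-total)

  *-monoˡ-⊑ : ∀ (r : BinRel X) {s t : BinRel X} → s ⊑ t → (s * r) ⊑ (t * r)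
  *-monoˡ-⊑ r {s} (dom-t⊆dom-s , s⊆t) =
    (λ x (y , ((z , txz , _) , r-total)) →
      let (z′ , sxz′) = dom-t⊆dom-s x (z , txz)
          r-total′ : ∀ w → s x w → ∃[ v ] r w v
          r-total′ w sxw = r-total w (s⊆t x w (z , txz) sxw)
          (v , rz′v) = r-total′ z′ sxz′ in
      v , ((z′ , sxz′ , rz′v) , r-total′)) ,
    (λ x y (_ , ((z₀ , txz₀ , _) , r-total)) ((z , sxz , rzy) , _) →
      (z , s⊆t x z (z₀ , txz₀) sxz , rzy) , r-total)

  Total : BinRel X → Set
  Total s = ∀ x → dom s x

  _⨾_ : BinRel X → BinRel X → BinRel X
  (s ⨾ t) x y = ∃[ z ] (s x z × t z y)

  *≈⨾-total : ∀ {s t : BinRel X} → Total t → (s * t) ≈ʳ (s ⨾ t)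
  *≈⨾-total t-total = (λ _ _ → proj₁) , (λ _ _ st → st , λ w _ → t-total w)

  ⊑⇔⊆ʳ-total : ∀ {s t : BinRel X} → Total s → Total t → (s ⊑ t) ⇔ (s ⊆ʳ t)
  ⊑⇔⊆ʳ-total s-total t-total =
    mk⇔ (λ (_ , s⊆t) x y → s⊆t x y (t-total x)) (λ s⊆t → (λ x _ → s-total x) , (λ x y _ → s⊆t x y))

open Relations

module Soundness {A : Set} {_≤_ : A → A → Set} {_·_ : A → A → A}
                 (R : Representation A _≤_ _·_) where
  open Representation R
  open Equivalence

  ⊑⇒≤ : ∀ {a b} → f a ⊑ f b → a ≤ b
  ⊑⇒≤ = from (f-order _ _)

  ≤⇒⊑ : ∀ {a b} → a ≤ b → f a ⊑ f b
  ≤⇒⊑ = to (f-order _ _)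

  ·-assoc : ∀ a b c → (a · b) · c ≡ a · (b · c)
  ·-assoc a b c = f-inj _ _ (begin
    f ((a · b) · c)       ≈⟨ f-hom (a · b) c ⟩
    f (a · b) * f c       ≈⟨ *-cong (f-hom a b) ≈ʳ-refl ⟩
    (f a * f b) * f c     ≈⟨ *-assoc (f a) (f b) (f c) ⟩
    f a * (f b * f c)     ≈⟨ *-cong ≈ʳ-refl (f-hom b c) ⟨
    f a * f (b · c)       ≈⟨ f-hom a (b · c) ⟨
    f (a · (b · c))       ∎)
    where open SetoidReasoning ≈ʳ-setoid

  isOrderedSemigroup : IsOrderedSemigroup A _≤_ _·_
  isOrderedSemigroup = record
    { isPartialOrder = record
      { isPreorder = record
        { isEquivalence = isEquivalence
        ; reflexive     = λ { refl → ⊑⇒≤ ⊑-refl }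
        ; trans         = λ a≤b b≤c → ⊑⇒≤ (⊑-trans (≤⇒⊑ a≤b) (≤⇒⊑ b≤c))
        }
      ; antisym = λ a≤b b≤a → f-inj _ _ (⊑-antisym (≤⇒⊑ a≤b) (≤⇒⊑ b≤a))
      }
    ; assoc = ·-assoc
    ; monoˡ = λ c a≤b →
        ⊑⇒≤ (⊑-resp-≈ʳ (≈ʳ-sym (f-hom c _)) (≈ʳ-sym (f-hom c _)) (*-monoʳ-⊑ (f c) (≤⇒⊑ a≤b)))
    ; monoʳ = λ c a≤b →
        ⊑⇒≤ (⊑-resp-≈ʳ (≈ʳ-sym (f-hom _ c)) (≈ʳ-sym (f-hom _ c)) (*-monoˡ-⊑ (f c) (≤⇒⊑ a≤b)))
    }

module Completeness {A : Set} {_≤_ : A → A → Set} {_·_ : A → A → A}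
                    (O : IsOrderedSemigroup A _≤_ _·_) where
  open IsOrderedSemigroup O
  open IsPartialOrder isPartialOrder using (antisym)
    renaming (refl to ≤-refl; trans to ≤-trans; reflexive to ≤-reflexive)

  -- Maybe A is A with an identity adjoined (nothing), acted on by A from the right.
  infixl 25 _◃_
  _◃_ : Maybe A → A → A
  nothing ◃ a = a
  just x  ◃ a = x · a

  ◃-assoc : ∀ x a b → x ◃ (a · b) ≡ (x ◃ a) · b
  ◃-assoc nothing  a b = refl
  ◃-assoc (just x) a b = sym (assoc x a b)

  ◃-mono : ∀ x {a b} → a ≤ b → x ◃ a ≤ x ◃ b
  ◃-mono nothing  a≤b = a≤b
  ◃-mono (just x) a≤b = monoˡ x a≤b

  ρ : A → BinRel (Maybe A)
  ρ a x nothing  = ⊥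
  ρ a x (just y) = y ≤ x ◃ a

  ρ-total : ∀ a → Total (ρ a)
  ρ-total a x = just (x ◃ a) , ≤-refl

  ρ-hom⨾ : ∀ a b → ρ (a · b) ≈ʳ (ρ a ⨾ ρ b)
  ρ-hom⨾ a b = split , merge
    where
    split : ρ (a · b) ⊆ʳ (ρ a ⨾ ρ b)
    split x (just y) y≤xab = just (x ◃ a) , ≤-refl , ≤-trans y≤xab (≤-reflexive (◃-assoc x a b))

    merge : (ρ a ⨾ ρ b) ⊆ʳ ρ (a · b)
    merge x (just y) (just z , z≤xa , y≤zb) =
      ≤-trans y≤zb (≤-trans (monoʳ b z≤xa) (≤-reflexive (sym (◃-assoc x a b))))

  ρ-hom : ∀ a b → ρ (a · b) ≈ʳ (ρ a * ρ b)
  ρ-hom a b = ≈ʳ-trans (ρ-hom⨾ a b) (≈ʳ-sym (*≈⨾-total (ρ-total b)))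

  ≤⇔ρ-⊆ʳ : ∀ a b → (a ≤ b) ⇔ (ρ a ⊆ʳ ρ b)
  ≤⇔ρ-⊆ʳ a b = mk⇔ (λ { a≤b x (just y) y≤xa → ≤-trans y≤xa (◃-mono x a≤b) })
                   (λ ρa⊆ρb → ρa⊆ρb nothing (just a) ≤-refl)

  ≤⇔ρ-⊑ : ∀ a b → (a ≤ b) ⇔ (ρ a ⊑ ρ b)
  ≤⇔ρ-⊑ a b = mk⇔ (λ a≤b → from ⊑⇔⊆ʳ (to (≤⇔ρ-⊆ʳ a b) a≤b))
                  (λ ρa⊑ρb → from (≤⇔ρ-⊆ʳ a b) (to ⊑⇔⊆ʳ ρa⊑ρb))
    where
    open Equivalence
    ⊑⇔⊆ʳ = ⊑⇔⊆ʳ-total (ρ-total a) (ρ-total b)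

  representation : Representation A _≤_ _·_
  representation = record
    { X        = Maybe A
    ; x₀       = nothing
    ; B        = λ s → ∃[ a ] (ρ a ≈ʳ s)
    ; B-resp   = λ t≈t′ (a , ρa≈t) → a , ≈ʳ-trans ρa≈t t≈t′
    ; B-closed = λ (a , ρa≈s) (b , ρb≈t) → a · b , ≈ʳ-trans (ρ-hom a b) (*-cong ρa≈s ρb≈t)
    ; f        = ρ
    ; f-into   = λ a → a , ≈ʳ-refl
    ; f-inj    = λ a b (ρa⊆ρb , ρb⊆ρa) →
        antisym (from (≤⇔ρ-⊆ʳ a b) ρa⊆ρb) (from (≤⇔ρ-⊆ʳ b a) ρb⊆ρa)
    ; f-surj   = λ _ inB → inB
    ; f-hom    = ρ-hom
    ; f-order  = ≤⇔ρ-⊑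
    }
    where open Equivalence

mainTheorem2 : (A : Set) (_≤_ : A → A → Set) (_·_ : A → A → A)
    → (InRDemonic A _≤_ _·_ → IsOrderedSemigroup A _≤_ _·_)
      × (IsOrderedSemigroup A _≤_ _·_ → InRDemonic A _≤_ _·_)
mainTheorem2 A _≤_ _·_ = Soundness.isOrderedSemigroup , Completeness.representation
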